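{- Let $G=(V,E)$ be a finite graph and $n\geq 2$ an integer. Let $A$ be an independent set of size $n-1$ in $G$ such that every vertex of $V\setminus A$ is adjacent to at most two vertices of $A$. Let $B=\bigcup_{\{u,v\}\subseteq A,\,u\neq v} (N_G(u)\cap N_G(v))$. Then $\mathrm{lk}(I_n(G),A\cup B)$ is a flag complex.
   Context: $N_G(u)$ is the set of neighbours of $u$. For a graph $G=(V,E)$, $I_n(G)=\{U\subseteq V:\ \alpha(G[U])<n\}$, where $\alpha$ is the independence number. For a simplicial complex $X$ and a set $\tau$, $\mathrm{lk}(X,\tau)=\{\sigma\in X:\ \sigma\cap\tau=\emptyset,\ \sigma\cup\tau\in X\}$. A missing face of a complex $X$ with vertex set $W$ is a set $\tau\subseteq W$ with $\tau\notin X$ but all proper subsets of $\tau$ in $X$; $X$ is a flag complex if all its missing faces have size $2$. -}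

module Defs where

open import Data.Nat using (ℕ; _<_)
open import Data.Fin using (Fin)
open import Data.Fin.Properties using (any?)
import Data.Fin.Properties as FinP
open import Data.Fin.Subset using (Subset; _∈_; _∉_; _⊆_; _⊂_; _∩_; _∪_; ⁅_⁆; ⊥; ∣_∣; Nonempty)
open import Data.Fin.Subset.Properties using (_∈?_)
open import Data.Vec using (tabulate)
open import Data.Product using (Σ; ∃; _×_; _,_)
open import Relation.Nullary using (¬_; Dec; does)
open import Relation.Nullary.Decidable using (_×-dec_; ¬?)
open import Relation.Binary.PropositionalEquality using (_≡_)
open import Relation.Binary using (Decidable)

record Graph (m : ℕ) : Set₁ where
  field
    Adj     : Fin m → Fin m → Set
    adj?    : Decidable Adj
    sym     : ∀ {x y} → Adj x y → Adj y x
    irrefl  : ∀ {x} → ¬ Adj x x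

open Graph public

module _ {m : ℕ} (G : Graph m) where

  N : Fin m → Subset m
  N u = tabulate (λ x → does (adj? G u x))

  Independent : Subset m → Set
  Independent U = ∀ {x y} → x ∈ U → y ∈ U → ¬ Adj G x y

  -- α(G[U]) < n : every independent subset of U has fewer than n elements
  αLess : Subset m → ℕ → Set
  αLess U n = ∀ S → S ⊆ U → Independent S → ∣ S ∣ < n

  I : ℕ → Subset m → Set
  I n U = αLess U n

  common? : (A : Subset m) (x : Fin m) →
            Dec (∃ λ u → ∃ λ v → u ∈ A × v ∈ A × ¬ (u ≡ v) × Adj G u x × Adj G v x)
  common? A x = any? λ u → any? λ v →
    (u ∈? A) ×-dec (v ∈? A) ×-dec ¬? (u FinP.≟ v) ×-dec adj? G u x ×-dec adj? G v x

  Bset : Subset m → Subset m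
  Bset A = tabulate (λ x → does (common? A x))

Complex : ℕ → Set₁
Complex m = Subset m → Set

lk : ∀ {m} → Complex m → Subset m → Complex m
lk X τ σ = (σ ∩ τ ≡ ⊥) × X (σ ∪ τ)

-- τ is a missing face of X (τ ⊆ vertex set W of X, τ ∉ X, proper subsets in X).
-- The vertex set W of X consists of the w with {w} ∈ X.
MissingFace : ∀ {m} → Complex m → Subset m → Set
MissingFace X τ = (∀ {w} → w ∈ τ → X ⁅ w ⁆) × ¬ X τ × (∀ ρ → ρ ⊂ τ → X ρ)

Flag : ∀ {m} → Complex m → Set
Flag X = ∀ τ → Nonempty τ → MissingFace X τ → ∣ τ ∣ ≡ 2

-- Let σ be a missing face of lk(I_n(G), A ∪ B) with at least three vertices; we show that σ is
-- a face after all. Its vertices lie outside B, so each has at most one neighbour in A. Suppose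
-- S ⊆ σ ∪ A ∪ B is independent with |S| ≥ n. For Q ⊆ S ∖ A the set W(Q) = (A ∖ N(Q)) ∪ Q is
-- independent, |W(Q)| + |A ∩ N(Q)| = |A| + |Q|, and W(S ∖ A) ⊇ S; shrink Q to a minimal set with
-- |W(Q)| ≥ n. If some x ∈ σ is not in Q, then W(Q) ⊆ (σ − x) ∪ A ∪ B contradicts σ − x being a
-- face. Otherwise σ ⊆ Q, and minimality gives |Q| ≤ |A ∩ N(Q)| + 1 and that every vertex of
-- A ∩ N(Q) has two neighbours in Q. Counting the edges between Q and A, where vertices of Q see
-- at most two vertices of A and those of σ at most one,
-- 2|A ∩ N(Q)| ≤ e(Q, A) ≤ 2|Q| − |σ| ≤ 2|A ∩ N(Q)| + 2 − |σ|, so |σ| ≤ 2.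

module Submission where

open import Defs
open import Data.Bool using (Bool; true; false; _∧_; if_then_else_)
open import Data.Empty using (⊥; ⊥-elim)
open import Data.Fin using (Fin; zero; suc)
open import Data.Fin.Properties using (_≟_; any?)
open import Data.Fin.Subset
  using (Subset; _∈_; _∉_; _⊆_; _∩_; _∪_; _─_; _-_; ∁; ⁅_⁆; ∣_∣; Nonempty; Empty)
open import Data.Fin.Subset.Properties
  using ( _∈?_; nonempty?; Empty-unique; ∣⊥∣≡0; ∣⁅x⁆∣≡1; x∈⁅x⁆; x∈⁅y⁆⇒x≡y
        ; ∉⊥; ⊆-refl; ⊆-trans; ⊆-antisym; p⊆q⇒∣p∣≤∣q∣; x∈p∩q⁺; x∈p∩q⁻; x∈p∪q⁻
        ; p⊆p∪q; q⊆p∪q; p∩q⊆p; p∩q⊆q; x∈∁p⇒x∉p; x∉p⇒x∈∁p; p─q⊆p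
        ; x∈p∧x≢y⇒x∈p-y; x∈p⇒p-x⊂p; x∈p⇒∣p-x∣<∣p∣ )
open import Data.Nat using (ℕ; zero; suc; _+_; _≤_; _<_; z≤n; s≤s; s≤s⁻¹; _≤?_)
open import Data.Nat.Properties
  using ( +-suc; +-comm; +-identityʳ; +-mono-≤; +-monoˡ-≤; +-monoʳ-≤; +-cancelˡ-≤; +-cancelʳ-≤; m≤m+n
        ; ≤-refl; ≤-trans; ≤-antisym; ≤-reflexive; <⇒≱; ≰⇒>; ≮⇒≥; module ≤-Reasoning
        ; +-0-commutativeMonoid; +-commutativeSemigroup )
open import Algebra.Properties.CommutativeMonoid.Sum +-0-commutativeMonoid
  using (sum; sum-syntax; ∑-comm; ∑-distrib-+; sum-cong-≗; sum-replicate-zero)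
open import Algebra.Properties.CommutativeSemigroup +-commutativeSemigroup
  using (xy∙z≈xz∙y)
open import Data.Product using (∃; _×_; _,_; proj₁; proj₂)
open import Data.Sum using (_⊎_; inj₁; inj₂)
open import Data.Vec using (_∷_; []; lookup; tabulate; here; there)
open import Data.Vec.Functional using (Vector)
open import Data.Vec.Properties using (lookup∘tabulate; lookup-zipWith; []=⇒lookup; lookup⇒[]=)
open import Function using (_∘_; mk⇔)
open import Level using (0ℓ)
open import Relation.Nullary using (¬_; Dec; yes; no; does)
open import Relation.Nullary.Decidable using (_×-dec_; ¬?; dec-true; does-⇔)
open import Relation.Unary using (Pred; Decidable)
open import Relation.Binary.PropositionalEquality
  using (_≡_; _≢_; refl; trans; cong; cong₂; subst; module ≡-Reasoning)
  renaming (sym to ≡-sym)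

toℕ : Bool → ℕ
toℕ true  = 1
toℕ false = 0

∧-leftComm : ∀ a b c → a ∧ (b ∧ c) ≡ b ∧ (a ∧ c)
∧-leftComm true  true  c = refl
∧-leftComm true  false c = refl
∧-leftComm false true  c = refl
∧-leftComm false false c = refl

sum-mono-≤ : ∀ {n} {f g : Vector ℕ n} → (∀ i → f i ≤ g i) → sum f ≤ sum g
sum-mono-≤ {zero}  f≤g = z≤n
sum-mono-≤ {suc n} f≤g = +-mono-≤ (f≤g zero) (sum-mono-≤ (f≤g ∘ suc))

does-true⇒ : ∀ {p} {P : Set p} (P? : Dec P) → does P? ≡ true → P
does-true⇒ (yes p) _ = p

module _ {n p} {P : Pred (Fin n) p} (P? : Decidable P) where

  ∈-tabulate-does⁺ : ∀ {x} → P x → x ∈ tabulate (does ∘ P?)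
  ∈-tabulate-does⁺ {x} px = lookup⇒[]= x _ (trans (lookup∘tabulate _ x) (dec-true (P? x) px))

  ∈-tabulate-does⁻ : ∀ {x} → x ∈ tabulate (does ∘ P?) → P x
  ∈-tabulate-does⁻ {x} x∈ = does-true⇒ (P? x) (trans (≡-sym (lookup∘tabulate _ x)) ([]=⇒lookup x∈))

x∈p─q⇒x∉q : ∀ {n} {x : Fin n} (p q : Subset n) → x ∈ p ─ q → x ∉ q
x∈p─q⇒x∉q (_ ∷ p) (_ ∷ q) (there x∈) (there x∈q) = x∈p─q⇒x∉q p q x∈ x∈q
x∈p─q⇒x∉q (_ ∷ p) (_ ∷ q) ()         here

x∈p-y⇒x≢y : ∀ {n} {x y : Fin n} (p : Subset n) → x ∈ p - y → x ≢ y
x∈p-y⇒x≢y {y = y} p x∈ refl = x∈p─q⇒x∉q p ⁅ y ⁆ x∈ (x∈⁅x⁆ y)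

∣p∣≡∑ : ∀ {n} (p : Subset n) → ∣ p ∣ ≡ ∑[ i < n ] toℕ (lookup p i)
∣p∣≡∑ []          = refl
∣p∣≡∑ (true  ∷ p) = cong suc (∣p∣≡∑ p)
∣p∣≡∑ (false ∷ p) = ∣p∣≡∑ p

∣p∪q∣+∣p∩q∣≡∣p∣+∣q∣ : ∀ {n} (p q : Subset n) → ∣ p ∪ q ∣ + ∣ p ∩ q ∣ ≡ ∣ p ∣ + ∣ q ∣
∣p∪q∣+∣p∩q∣≡∣p∣+∣q∣ []          []          = refl
∣p∪q∣+∣p∩q∣≡∣p∣+∣q∣ (true  ∷ p) (true  ∷ q) =
  cong suc (trans (+-suc _ _) (trans (cong suc (∣p∪q∣+∣p∩q∣≡∣p∣+∣q∣ p q)) (≡-sym (+-suc _ _))))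
∣p∪q∣+∣p∩q∣≡∣p∣+∣q∣ (true  ∷ p) (false ∷ q) = cong suc (∣p∪q∣+∣p∩q∣≡∣p∣+∣q∣ p q)
∣p∪q∣+∣p∩q∣≡∣p∣+∣q∣ (false ∷ p) (true  ∷ q) =
  trans (cong suc (∣p∪q∣+∣p∩q∣≡∣p∣+∣q∣ p q)) (≡-sym (+-suc _ _))
∣p∪q∣+∣p∩q∣≡∣p∣+∣q∣ (false ∷ p) (false ∷ q) = ∣p∪q∣+∣p∩q∣≡∣p∣+∣q∣ p q

∣p∩∁q∣+∣p∩q∣≡∣p∣ : ∀ {n} (p q : Subset n) → ∣ p ∩ ∁ q ∣ + ∣ p ∩ q ∣ ≡ ∣ p ∣
∣p∩∁q∣+∣p∩q∣≡∣p∣ []          []          = refl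
∣p∩∁q∣+∣p∩q∣≡∣p∣ (true  ∷ p) (true  ∷ q) = trans (+-suc _ _) (cong suc (∣p∩∁q∣+∣p∩q∣≡∣p∣ p q))
∣p∩∁q∣+∣p∩q∣≡∣p∣ (true  ∷ p) (false ∷ q) = cong suc (∣p∩∁q∣+∣p∩q∣≡∣p∣ p q)
∣p∩∁q∣+∣p∩q∣≡∣p∣ (false ∷ p) (_     ∷ q) = ∣p∩∁q∣+∣p∩q∣≡∣p∣ p q

∣p∪q∣≤∣p∣+∣q∣ : ∀ {n} (p q : Subset n) → ∣ p ∪ q ∣ ≤ ∣ p ∣ + ∣ q ∣
∣p∪q∣≤∣p∣+∣q∣ p q = subst (∣ p ∪ q ∣ ≤_) (∣p∪q∣+∣p∩q∣≡∣p∣+∣q∣ p q) (m≤m+n _ _)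

Empty⇒∣p∣≡0 : ∀ {n} {p : Subset n} → Empty p → ∣ p ∣ ≡ 0
Empty⇒∣p∣≡0 {n} empty = trans (cong ∣_∣ (Empty-unique empty)) (∣⊥∣≡0 n)

Empty[p∩q]⇒∣p∪q∣≡∣p∣+∣q∣ : ∀ {n} {p q : Subset n} → Empty (p ∩ q) → ∣ p ∪ q ∣ ≡ ∣ p ∣ + ∣ q ∣
Empty[p∩q]⇒∣p∪q∣≡∣p∣+∣q∣ {p = p} {q} disjoint = begin
  ∣ p ∪ q ∣             ≡⟨ ≡-sym (+-identityʳ _) ⟩
  ∣ p ∪ q ∣ + 0         ≡⟨ cong (∣ p ∪ q ∣ +_) (≡-sym (Empty⇒∣p∣≡0 disjoint)) ⟩
  ∣ p ∪ q ∣ + ∣ p ∩ q ∣ ≡⟨ ∣p∪q∣+∣p∩q∣≡∣p∣+∣q∣ p q ⟩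
  ∣ p ∣ + ∣ q ∣         ∎
  where open ≡-Reasoning

∣p∪⁅x⁆∣≤∣p∣+1 : ∀ {n} (p : Subset n) x → ∣ p ∪ ⁅ x ⁆ ∣ ≤ ∣ p ∣ + 1
∣p∪⁅x⁆∣≤∣p∣+1 p x = subst (λ k → ∣ p ∪ ⁅ x ⁆ ∣ ≤ ∣ p ∣ + k) (∣⁅x⁆∣≡1 x) (∣p∪q∣≤∣p∣+∣q∣ p ⁅ x ⁆)

x∉p⇒∣p∪⁅x⁆∣≡∣p∣+1 : ∀ {n} {p : Subset n} {x} → x ∉ p → ∣ p ∪ ⁅ x ⁆ ∣ ≡ ∣ p ∣ + 1
x∉p⇒∣p∪⁅x⁆∣≡∣p∣+1 {p = p} {x} x∉p =
  trans (Empty[p∩q]⇒∣p∪q∣≡∣p∣+∣q∣ disjoint) (cong (∣ p ∣ +_) (∣⁅x⁆∣≡1 x))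
  where
  disjoint : Empty (p ∩ ⁅ x ⁆)
  disjoint (y , y∈) with x∈p∩q⁻ p ⁅ x ⁆ y∈
  ... | y∈p , y∈⁅x⁆ = x∉p (subst (_∈ p) (x∈⁅y⁆⇒x≡y x y∈⁅x⁆) y∈p)

2≤∣p∣ : ∀ {n} {p : Subset n} {x y} → x ∈ p → y ∈ p → x ≢ y → 2 ≤ ∣ p ∣
2≤∣p∣ {p = p} {x} x∈p y∈p x≢y = ≤-trans (s≤s 1≤∣p-x∣) (x∈p⇒∣p-x∣<∣p∣ x∈p)
  where
  1≤∣p-x∣ : 1 ≤ ∣ p - x ∣
  1≤∣p-x∣ = ≤-trans (s≤s z≤n) (x∈p⇒∣p-x∣<∣p∣ (x∈p∧x≢y⇒x∈p-y y∈p (x≢y ∘ ≡-sym)))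

∣p∣≤1 : ∀ {n} {p : Subset n} → (∀ {x y} → x ∈ p → y ∈ p → x ≡ y) → ∣ p ∣ ≤ 1
∣p∣≤1 {p = p} unique with nonempty? p
... | yes (x , x∈p) = subst (∣ p ∣ ≤_) (∣⁅x⁆∣≡1 x) (p⊆q⇒∣p∣≤∣q∣ λ y∈p → subst (_∈ ⁅ x ⁆) (unique x∈p y∈p) (x∈⁅x⁆ x))
... | no  empty     = subst (_≤ 1) (≡-sym (Empty⇒∣p∣≡0 empty)) z≤n

minimal-subset : ∀ {n ℓ} {P : Pred (Subset n) ℓ} → Decidable P → ∀ {Q} → P Q →
                 ∃ λ R → R ⊆ Q × P R × (∀ {q} → q ∈ R → ¬ P (R - q))
minimal-subset {P = P} P? {Q} pQ = descend (suc ∣ Q ∣) ≤-refl pQ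
  where
  descend : ∀ k {Q} → ∣ Q ∣ < k → P Q → ∃ λ R → R ⊆ Q × P R × (∀ {q} → q ∈ R → ¬ P (R - q))
  descend (suc k) {Q} ∣Q∣<k pQ with any? (λ q → q ∈? Q ×-dec P? (Q - q))
  ... | no  none = Q , ⊆-refl , pQ , λ q∈Q pQ-q → none (_ , q∈Q , pQ-q)
  ... | yes (q , q∈Q , pQ-q) with descend k (≤-trans (x∈p⇒∣p-x∣<∣p∣ q∈Q) (s≤s⁻¹ ∣Q∣<k)) pQ-q
  ...   | R , R⊆Q-q , pR , minimal = R , ⊆-trans R⊆Q-q (p─q⊆p Q ⁅ q ⁆) , pR , minimal

lk-vertex⇒∉ : ∀ {m} {X : Complex m} {τ : Subset m} {w} → lk X τ ⁅ w ⁆ → w ∉ τ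
lk-vertex⇒∉ {w = w} (⁅w⁆∩τ≡∅ , _) w∈τ = ∉⊥ (subst (w ∈_) ⁅w⁆∩τ≡∅ (x∈p∩q⁺ (x∈⁅x⁆ w , w∈τ)))

lk-face : ∀ {m} {X : Complex m} {τ σ} → (∀ {w} → w ∈ σ → lk X τ ⁅ w ⁆) → X (σ ∪ τ) → lk X τ σ
lk-face {X = X} {τ} {σ} vertex Xσ∪τ = Empty-unique disjoint , Xσ∪τ
  where
  disjoint : Empty (σ ∩ τ)
  disjoint (x , x∈σ∩τ) with x∈p∩q⁻ σ τ x∈σ∩τ
  ... | x∈σ , x∈τ = lk-vertex⇒∉ {X = X} (vertex x∈σ) x∈τ

2≤∣missingFace∣ : ∀ {m} {X : Complex m} {σ} → Nonempty σ → MissingFace X σ → 2 ≤ ∣ σ ∣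
2≤∣missingFace∣ {X = X} {σ} (x , x∈σ) (vertex , nonface , _) with nonempty? (σ - x)
... | yes (y , y∈σ-x) = 2≤∣p∣ x∈σ (p─q⊆p σ ⁅ x ⁆ y∈σ-x) (x∈p-y⇒x≢y σ y∈σ-x ∘ ≡-sym)
... | no  σ-x-empty   = ⊥-elim (nonface (subst X (⊆-antisym ⁅x⁆⊆σ σ⊆⁅x⁆) (vertex x∈σ)))
  where
  ⁅x⁆⊆σ : ⁅ x ⁆ ⊆ σ
  ⁅x⁆⊆σ y∈⁅x⁆ = subst (_∈ σ) (≡-sym (x∈⁅y⁆⇒x≡y x y∈⁅x⁆)) x∈σ
  σ⊆⁅x⁆ : σ ⊆ ⁅ x ⁆
  σ⊆⁅x⁆ {y} y∈σ with y ≟ x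
  ... | yes refl = x∈⁅x⁆ x
  ... | no  y≢x  = ⊥-elim (σ-x-empty (y , x∈p∧x≢y⇒x∈p-y y∈σ y≢x))

flag-if-missingFaces-≤2 : ∀ {m} {X : Complex m} → (∀ σ → MissingFace X σ → ∣ σ ∣ ≤ 2) → Flag X
flag-if-missingFaces-≤2 ≤2 σ nonempty missing = ≤-antisym (≤2 σ missing) (2≤∣missingFace∣ nonempty missing)

module _ {m} (G : Graph m) where

  ∈N⁺ : ∀ {u x} → Adj G u x → x ∈ N G u
  ∈N⁺ {u} = ∈-tabulate-does⁺ (adj? G u)

  ∈N⁻ : ∀ {u x} → x ∈ N G u → Adj G u x
  ∈N⁻ {u} = ∈-tabulate-does⁻ (adj? G u)

  ∉Bset⇒∣A∩N∣≤1 : ∀ {A x} → x ∉ Bset G A → ∣ A ∩ N G x ∣ ≤ 1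
  ∉Bset⇒∣A∩N∣≤1 {A} {x} x∉B = ∣p∣≤1 λ {u} {v} u∈ v∈ → unique (x∈p∩q⁻ A _ u∈) (x∈p∩q⁻ A _ v∈)
    where
    unique : ∀ {u v} → u ∈ A × u ∈ N G x → v ∈ A × v ∈ N G x → u ≡ v
    unique {u} {v} (u∈A , xu) (v∈A , xv) with u ≟ v
    ... | yes u≡v = u≡v
    ... | no  u≢v = ⊥-elim (x∉B (∈-tabulate-does⁺ (common? G A)
                      (u , v , u∈A , v∈A , u≢v , sym G (∈N⁻ xu) , sym G (∈N⁻ xv))))

  HasNeighbourIn : Subset m → Pred (Fin m) 0ℓ
  HasNeighbourIn Q v = ∃ λ q → q ∈ Q × Adj G q v

  hasNeighbourIn? : ∀ Q → Decidable (HasNeighbourIn Q)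
  hasNeighbourIn? Q v = any? λ q → q ∈? Q ×-dec adj? G q v

  N[_] : Subset m → Subset m
  N[ Q ] = tabulate (does ∘ hasNeighbourIn? Q)

  ∈N[]⁺ : ∀ {Q q v} → q ∈ Q → Adj G q v → v ∈ N[ Q ]
  ∈N[]⁺ {Q} q∈Q qv = ∈-tabulate-does⁺ (hasNeighbourIn? Q) (_ , q∈Q , qv)

  ∈N[]⁻ : ∀ {Q v} → v ∈ N[ Q ] → HasNeighbourIn Q v
  ∈N[]⁻ {Q} = ∈-tabulate-does⁻ (hasNeighbourIn? Q)

  N[]-mono : ∀ {Q R} → Q ⊆ R → N[ Q ] ⊆ N[ R ]
  N[]-mono Q⊆R v∈ with ∈N[]⁻ v∈
  ... | q , q∈Q , qv = ∈N[]⁺ (Q⊆R q∈Q) qv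

  edges : Subset m → Subset m → ℕ
  edges P R = ∑[ p < m ] ∑[ r < m ] toℕ (lookup P p ∧ lookup R r ∧ does (adj? G p r))

  edges-comm : ∀ P R → edges P R ≡ edges R P
  edges-comm P R = trans (∑-comm {m} {m} _) (sum-cong-≗ λ r → sum-cong-≗ λ p → cong toℕ (begin
    lookup P p ∧ lookup R r ∧ does (adj? G p r) ≡⟨ ∧-leftComm (lookup P p) (lookup R r) _ ⟩
    lookup R r ∧ lookup P p ∧ does (adj? G p r) ≡⟨ cong (λ b → lookup R r ∧ lookup P p ∧ b) adj-sym ⟩
    lookup R r ∧ lookup P p ∧ does (adj? G r p) ∎))
    where
    open ≡-Reasoning
    adj-sym : ∀ {p r} → does (adj? G p r) ≡ does (adj? G r p)
    adj-sym {p} {r} = does-⇔ (mk⇔ (sym G) (sym G)) (adj? G p r) (adj? G r p)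

  edges≡∑∣R∩N∣ : ∀ P R → edges P R ≡ ∑[ p < m ] (if lookup P p then ∣ R ∩ N G p ∣ else 0)
  edges≡∑∣R∩N∣ P R = sum-cong-≗ row
    where
    row : ∀ p → ∑[ r < m ] toℕ (lookup P p ∧ lookup R r ∧ does (adj? G p r))
              ≡ (if lookup P p then ∣ R ∩ N G p ∣ else 0)
    row p with lookup P p
    ... | false = sum-replicate-zero m
    ... | true  = ≡-sym (trans (∣p∣≡∑ (R ∩ N G p)) (sum-cong-≗ λ r →
                    cong toℕ (trans (lookup-zipWith _∧_ r R (N G p)) (cong (lookup R r ∧_) (lookup∘tabulate _ r)))))

  module Exchange (A : Subset m) where

    W : Subset m → Subset m
    W Q = (A ∩ ∁ N[ Q ]) ∪ Q

    ∈W⁻ : ∀ {Q x} → x ∈ W Q → (x ∈ A × x ∉ N[ Q ]) ⊎ x ∈ Q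
    ∈W⁻ {Q} x∈W with x∈p∪q⁻ (A ∩ ∁ N[ Q ]) Q x∈W
    ... | inj₂ x∈Q    = inj₂ x∈Q
    ... | inj₁ x∈A∖N with x∈p∩q⁻ A (∁ N[ Q ]) x∈A∖N
    ...   | x∈A , x∈∁N = inj₁ (x∈A , x∈∁p⇒x∉p x∈∁N)

    ∈W⁺ˡ : ∀ {Q x} → x ∈ A → x ∉ N[ Q ] → x ∈ W Q
    ∈W⁺ˡ {Q} x∈A x∉N = p⊆p∪q Q (x∈p∩q⁺ (x∈A , x∉p⇒x∈∁p x∉N))

    ∈W⁺ʳ : ∀ {Q x} → x ∈ Q → x ∈ W Q
    ∈W⁺ʳ {Q} = q⊆p∪q (A ∩ ∁ N[ Q ]) Q

    W-independent : ∀ {Q} → Independent G A → Independent G Q → Independent G (W Q)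
    W-independent indA indQ x∈W y∈W xy with ∈W⁻ x∈W | ∈W⁻ y∈W
    ... | inj₁ (x∈A , _)   | inj₁ (y∈A , _)   = indA x∈A y∈A xy
    ... | inj₁ (_ , x∉N)   | inj₂ y∈Q         = x∉N (∈N[]⁺ y∈Q (sym G xy))
    ... | inj₂ x∈Q         | inj₁ (_ , y∉N)   = y∉N (∈N[]⁺ x∈Q xy)
    ... | inj₂ x∈Q         | inj₂ y∈Q         = indQ x∈Q y∈Q xy

    ∣W∣+∣A∩N[]∣≡∣A∣+∣Q∣ : ∀ {Q} → Q ⊆ ∁ A → ∣ W Q ∣ + ∣ A ∩ N[ Q ] ∣ ≡ ∣ A ∣ + ∣ Q ∣
    ∣W∣+∣A∩N[]∣≡∣A∣+∣Q∣ {Q} Q⊆∁A = begin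
      ∣ W Q ∣ + ∣ A ∩ N[ Q ] ∣                   ≡⟨ cong (_+ ∣ A ∩ N[ Q ] ∣) (Empty[p∩q]⇒∣p∪q∣≡∣p∣+∣q∣ disjoint) ⟩
      ∣ A ∩ ∁ N[ Q ] ∣ + ∣ Q ∣ + ∣ A ∩ N[ Q ] ∣   ≡⟨ xy∙z≈xz∙y ∣ A ∩ ∁ N[ Q ] ∣ _ _ ⟩
      ∣ A ∩ ∁ N[ Q ] ∣ + ∣ A ∩ N[ Q ] ∣ + ∣ Q ∣   ≡⟨ cong (_+ ∣ Q ∣) (∣p∩∁q∣+∣p∩q∣≡∣p∣ A N[ Q ]) ⟩
      ∣ A ∣ + ∣ Q ∣                               ∎
      where
      open ≡-Reasoning
      disjoint : Empty ((A ∩ ∁ N[ Q ]) ∩ Q)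
      disjoint (x , x∈) with x∈p∩q⁻ (A ∩ ∁ N[ Q ]) Q x∈
      ... | x∈A∖N , x∈Q = x∈∁p⇒x∉p (Q⊆∁A x∈Q) (proj₁ (x∈p∩q⁻ A _ x∈A∖N))

    W⊆W[Q-q]∪⁅q⁆ : ∀ {Q} q → W Q ⊆ W (Q - q) ∪ ⁅ q ⁆
    W⊆W[Q-q]∪⁅q⁆ {Q} q {x} x∈W with ∈W⁻ x∈W
    ... | inj₁ (x∈A , x∉N) = p⊆p∪q ⁅ q ⁆ (∈W⁺ˡ x∈A (x∉N ∘ N[]-mono (p─q⊆p Q ⁅ q ⁆)))
    ... | inj₂ x∈Q with x ≟ q
    ...   | yes refl = q⊆p∪q (W (Q - q)) ⁅ q ⁆ (x∈⁅x⁆ q)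
    ...   | no  x≢q  = p⊆p∪q ⁅ q ⁆ (∈W⁺ʳ (x∈p∧x≢y⇒x∈p-y x∈Q x≢q))

    ∣W∣≤∣W[Q-q]∣+1 : ∀ Q q → ∣ W Q ∣ ≤ ∣ W (Q - q) ∣ + 1
    ∣W∣≤∣W[Q-q]∣+1 Q q = ≤-trans (p⊆q⇒∣p∣≤∣q∣ (W⊆W[Q-q]∪⁅q⁆ q)) (∣p∪⁅x⁆∣≤∣p∣+1 (W (Q - q)) q)

    -- W (Q - q) gains v, which is not in W Q, and loses at most q.
    ∣W∣≤∣W[Q-q]∣ : ∀ {Q q v} → Q ⊆ ∁ A → v ∈ A → q ∈ Q → Adj G q v →
                   (∀ {q′} → q′ ∈ Q → Adj G q′ v → q′ ≡ q) → ∣ W Q ∣ ≤ ∣ W (Q - q) ∣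
    ∣W∣≤∣W[Q-q]∣ {Q} {q} {v} Q⊆∁A v∈A q∈Q qv unique = +-cancelʳ-≤ 1 _ _ (begin
      ∣ W Q ∣ + 1               ≡⟨ ≡-sym (x∉p⇒∣p∪⁅x⁆∣≡∣p∣+1 v∉WQ) ⟩
      ∣ W Q ∪ ⁅ v ⁆ ∣           ≤⟨ p⊆q⇒∣p∣≤∣q∣ WQ∪⁅v⁆⊆W[Q-q]∪⁅q⁆ ⟩
      ∣ W (Q - q) ∪ ⁅ q ⁆ ∣     ≤⟨ ∣p∪⁅x⁆∣≤∣p∣+1 (W (Q - q)) q ⟩
      ∣ W (Q - q) ∣ + 1         ∎)
      where
      open ≤-Reasoning
      v∉WQ : v ∉ W Q
      v∉WQ v∈WQ with ∈W⁻ v∈WQ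
      ... | inj₁ (_ , v∉N) = v∉N (∈N[]⁺ q∈Q qv)
      ... | inj₂ v∈Q       = x∈∁p⇒x∉p (Q⊆∁A v∈Q) v∈A
      v∉N[Q-q] : v ∉ N[ Q - q ]
      v∉N[Q-q] v∈N with ∈N[]⁻ v∈N
      ... | q′ , q′∈Q-q , q′v = x∈p-y⇒x≢y Q q′∈Q-q (unique (p─q⊆p Q ⁅ q ⁆ q′∈Q-q) q′v)
      WQ∪⁅v⁆⊆W[Q-q]∪⁅q⁆ : W Q ∪ ⁅ v ⁆ ⊆ W (Q - q) ∪ ⁅ q ⁆
      WQ∪⁅v⁆⊆W[Q-q]∪⁅q⁆ x∈ with x∈p∪q⁻ (W Q) ⁅ v ⁆ x∈
      ... | inj₁ x∈WQ  = W⊆W[Q-q]∪⁅q⁆ q x∈WQ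
      ... | inj₂ x∈⁅v⁆ rewrite x∈⁅y⁆⇒x≡y v x∈⁅v⁆ = p⊆p∪q ⁅ q ⁆ (∈W⁺ˡ v∈A v∉N[Q-q])

    module Minimal {n : ℕ} {Q} (Q⊆∁A : Q ⊆ ∁ A) (large : n ≤ ∣ W Q ∣)
                   (minimal : ∀ {q} → q ∈ Q → ¬ n ≤ ∣ W (Q - q) ∣) where

      2≤∣Q∩N∣ : ∀ {v} → v ∈ A → v ∈ N[ Q ] → 2 ≤ ∣ Q ∩ N G v ∣
      2≤∣Q∩N∣ {v} v∈A v∈N with ∈N[]⁻ v∈N
      ... | q , q∈Q , qv with any? (λ q′ → q′ ∈? Q ×-dec ¬? (q′ ≟ q) ×-dec adj? G q′ v)
      ...   | yes (q′ , q′∈Q , q′≢q , q′v) = 2≤∣p∣ (∈Q∩N q∈Q qv) (∈Q∩N q′∈Q q′v) (q′≢q ∘ ≡-sym)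
        where
        ∈Q∩N : ∀ {x} → x ∈ Q → Adj G x v → x ∈ Q ∩ N G v
        ∈Q∩N x∈Q xv = x∈p∩q⁺ (x∈Q , ∈N⁺ (sym G xv))
      ...   | no  none = ⊥-elim (minimal q∈Q (≤-trans large (∣W∣≤∣W[Q-q]∣ Q⊆∁A v∈A q∈Q qv unique)))
        where
        unique : ∀ {q′} → q′ ∈ Q → Adj G q′ v → q′ ≡ q
        unique {q′} q′∈Q q′v with q′ ≟ q
        ... | yes q′≡q = q′≡q
        ... | no  q′≢q = ⊥-elim (none (q′ , q′∈Q , q′≢q , q′v))

      ∣Q∣≤1+∣A∩N[Q]∣ : suc ∣ A ∣ ≡ n → ∣ Q ∣ ≤ suc ∣ A ∩ N[ Q ] ∣
      ∣Q∣≤1+∣A∩N[Q]∣ hA with nonempty? Q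
      ... | no  empty     = subst (_≤ suc ∣ A ∩ N[ Q ] ∣) (≡-sym (Empty⇒∣p∣≡0 empty)) z≤n
      ... | yes (q , q∈Q) = +-cancelˡ-≤ ∣ A ∣ _ _ (begin
        ∣ A ∣ + ∣ Q ∣          ≡⟨ ≡-sym (∣W∣+∣A∩N[]∣≡∣A∣+∣Q∣ Q⊆∁A) ⟩
        ∣ W Q ∣ + M            ≤⟨ +-monoˡ-≤ M ∣WQ∣≤n ⟩
        n + M                  ≡⟨ cong (_+ M) (≡-sym hA) ⟩
        suc ∣ A ∣ + M          ≡⟨ ≡-sym (+-suc ∣ A ∣ M) ⟩
        ∣ A ∣ + suc M          ∎)
        where
        open ≤-Reasoning
        M = ∣ A ∩ N[ Q ] ∣
        ∣WQ∣≤n : ∣ W Q ∣ ≤ n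
        ∣WQ∣≤n = ≤-trans (∣W∣≤∣W[Q-q]∣+1 Q q) (subst (_≤ n) (+-comm 1 _) (≰⇒> (minimal q∈Q)))

      ∣A∩N[Q]∣+∣A∩N[Q]∣≤edges : ∣ A ∩ N[ Q ] ∣ + ∣ A ∩ N[ Q ] ∣ ≤ edges Q A
      ∣A∩N[Q]∣+∣A∩N[Q]∣≤edges = begin
        ∣ A ∩ N[ Q ] ∣ + ∣ A ∩ N[ Q ] ∣
          ≡⟨ cong₂ _+_ (∣p∣≡∑ (A ∩ N[ Q ])) (∣p∣≡∑ (A ∩ N[ Q ])) ⟩
        ∑[ v < m ] inAN v + ∑[ v < m ] inAN v
          ≡⟨ ≡-sym (∑-distrib-+ inAN inAN) ⟩
        ∑[ v < m ] (inAN v + inAN v)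
          ≤⟨ sum-mono-≤ pointwise ⟩
        ∑[ v < m ] (if lookup A v then ∣ Q ∩ N G v ∣ else 0)
          ≡⟨ ≡-sym (edges≡∑∣R∩N∣ A Q) ⟩
        edges A Q
          ≡⟨ edges-comm A Q ⟩
        edges Q A ∎
        where
        open ≤-Reasoning
        inAN : Fin m → ℕ
        inAN v = toℕ (lookup (A ∩ N[ Q ]) v)
        pointwise : ∀ v → inAN v + inAN v ≤ (if lookup A v then ∣ Q ∩ N G v ∣ else 0)
        pointwise v rewrite lookup-zipWith _∧_ v A N[ Q ] with lookup A v in eA | lookup N[ Q ] v in eN
        ... | false | _     = z≤n
        ... | true  | false = z≤n
        ... | true  | true  = 2≤∣Q∩N∣ (lookup⇒[]= v A eA) (lookup⇒[]= v N[ Q ] eN)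

      edges+∣P∣≤∣Q∣+∣Q∣ : ∀ {P} → (∀ x → x ∉ A → ∣ A ∩ N G x ∣ ≤ 2) → P ⊆ Q →
                          (∀ {u} → u ∈ P → ∣ A ∩ N G u ∣ ≤ 1) → edges Q A + ∣ P ∣ ≤ ∣ Q ∣ + ∣ Q ∣
      edges+∣P∣≤∣Q∣+∣Q∣ {P} deg≤2 P⊆Q deg≤1 = begin
        edges Q A + ∣ P ∣
          ≡⟨ cong₂ _+_ (edges≡∑∣R∩N∣ Q A) (∣p∣≡∑ P) ⟩
        ∑[ u < m ] degQ u + ∑[ u < m ] inP u
          ≡⟨ ≡-sym (∑-distrib-+ degQ inP) ⟩
        ∑[ u < m ] (degQ u + inP u)
          ≤⟨ sum-mono-≤ pointwise ⟩
        ∑[ u < m ] (inQ u + inQ u)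
          ≡⟨ ∑-distrib-+ inQ inQ ⟩
        ∑[ u < m ] inQ u + ∑[ u < m ] inQ u
          ≡⟨ ≡-sym (cong₂ _+_ (∣p∣≡∑ Q) (∣p∣≡∑ Q)) ⟩
        ∣ Q ∣ + ∣ Q ∣ ∎
        where
        open ≤-Reasoning
        degQ inP inQ : Fin m → ℕ
        degQ u = if lookup Q u then ∣ A ∩ N G u ∣ else 0
        inP u = toℕ (lookup P u)
        inQ u = toℕ (lookup Q u)
        pointwise : ∀ u → degQ u + inP u ≤ inQ u + inQ u
        pointwise u with lookup Q u in eQ | lookup P u in eP
        ... | false | false = z≤n
        ... | false | true  with () ← trans (≡-sym ([]=⇒lookup (P⊆Q (lookup⇒[]= u P eP)))) eQ
        ... | true  | false = ≤-trans (≤-reflexive (+-identityʳ _))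
                                      (deg≤2 u (x∈∁p⇒x∉p (Q⊆∁A (lookup⇒[]= u Q eQ))))
        ... | true  | true  = +-monoˡ-≤ 1 (deg≤1 (lookup⇒[]= u P eP))

      ∣P∣≤2 : ∀ {P} → suc ∣ A ∣ ≡ n → (∀ x → x ∉ A → ∣ A ∩ N G x ∣ ≤ 2) → P ⊆ Q →
              (∀ {u} → u ∈ P → ∣ A ∩ N G u ∣ ≤ 1) → ∣ P ∣ ≤ 2
      ∣P∣≤2 {P} hA deg≤2 P⊆Q deg≤1 = +-cancelˡ-≤ (edges Q A) _ _ (begin
        edges Q A + ∣ P ∣  ≤⟨ edges+∣P∣≤∣Q∣+∣Q∣ deg≤2 P⊆Q deg≤1 ⟩
        ∣ Q ∣ + ∣ Q ∣      ≤⟨ +-mono-≤ (∣Q∣≤1+∣A∩N[Q]∣ hA) (∣Q∣≤1+∣A∩N[Q]∣ hA) ⟩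
        suc M + suc M      ≡⟨ cong suc (+-suc M M) ⟩
        2 + (M + M)        ≤⟨ +-monoʳ-≤ 2 ∣A∩N[Q]∣+∣A∩N[Q]∣≤edges ⟩
        2 + edges Q A      ≡⟨ +-comm 2 (edges Q A) ⟩
        edges Q A + 2      ∎)
        where
        open ≤-Reasoning
        M = ∣ A ∩ N[ Q ] ∣

  module _ {n : ℕ} {A : Subset m} (indA : Independent G A) (hA : suc ∣ A ∣ ≡ n)
           (deg≤2 : ∀ x → x ∉ A → ∣ A ∩ N G x ∣ ≤ 2) where

    open Exchange A

    αLess-σ∪A∪B : ∀ {σ} → (∀ {w} → w ∈ σ → w ∉ A ∪ Bset G A) →
                  (∀ {x} → x ∈ σ → αLess G ((σ - x) ∪ (A ∪ Bset G A)) n) → 3 ≤ ∣ σ ∣ →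
                  αLess G (σ ∪ (A ∪ Bset G A)) n
    αLess-σ∪A∪B {σ} outside faces 3≤∣σ∣ S S⊆σ∪τ indS = ≰⇒> λ n≤∣S∣ →
      let Q , Q⊆Q₀ , large , minimal = minimal-subset (λ Q → n ≤? ∣ W Q ∣)
                                         (≤-trans n≤∣S∣ (p⊆q⇒∣p∣≤∣q∣ S⊆WQ₀))
      in impossible Q⊆Q₀ large minimal
      where
      τ Q₀ : Subset m
      τ  = A ∪ Bset G A
      Q₀ = S ∩ ∁ A

      S⊆WQ₀ : S ⊆ W Q₀
      S⊆WQ₀ {y} y∈S with y ∈? A
      ... | no  y∉A = ∈W⁺ʳ (x∈p∩q⁺ (y∈S , x∉p⇒x∈∁p y∉A))
      ... | yes y∈A = ∈W⁺ˡ y∈A λ y∈N → let q , q∈Q₀ , qy = ∈N[]⁻ y∈N in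
                                         indS (p∩q⊆p S (∁ A) q∈Q₀) y∈S qy

      impossible : ∀ {Q} → Q ⊆ Q₀ → n ≤ ∣ W Q ∣ → (∀ {q} → q ∈ Q → ¬ n ≤ ∣ W (Q - q) ∣) → ⊥
      impossible {Q} Q⊆Q₀ large minimal with any? (λ x → x ∈? σ ×-dec ¬? (x ∈? Q))
      ... | yes (x , x∈σ , x∉Q) = <⇒≱ (faces x∈σ (W Q) WQ⊆[σ-x]∪τ (W-independent indA indQ)) large
        where
        Q⊆S : Q ⊆ S
        Q⊆S = p∩q⊆p S (∁ A) ∘ Q⊆Q₀
        indQ : Independent G Q
        indQ x∈Q y∈Q = indS (Q⊆S x∈Q) (Q⊆S y∈Q)
        WQ⊆[σ-x]∪τ : W Q ⊆ (σ - x) ∪ τ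
        WQ⊆[σ-x]∪τ y∈WQ with ∈W⁻ y∈WQ
        ... | inj₁ (y∈A , _) = q⊆p∪q (σ - x) τ (p⊆p∪q (Bset G A) y∈A)
        ... | inj₂ y∈Q with x∈p∪q⁻ σ τ (S⊆σ∪τ (Q⊆S y∈Q))
        ...   | inj₂ y∈τ = q⊆p∪q (σ - x) τ y∈τ
        ...   | inj₁ y∈σ = p⊆p∪q τ (x∈p∧x≢y⇒x∈p-y y∈σ λ { refl → x∉Q y∈Q })
      ... | no  none = <⇒≱ 3≤∣σ∣ (Minimal.∣P∣≤2 (p∩q⊆q S (∁ A) ∘ Q⊆Q₀) large minimal hA deg≤2 σ⊆Q deg≤1)
        where
        σ⊆Q : σ ⊆ Q
        σ⊆Q {y} y∈σ with y ∈? Q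
        ... | yes y∈Q = y∈Q
        ... | no  y∉Q = ⊥-elim (none (y , y∈σ , y∉Q))
        deg≤1 : ∀ {u} → u ∈ σ → ∣ A ∩ N G u ∣ ≤ 1
        deg≤1 u∈σ = ∉Bset⇒∣A∩N∣≤1 (outside u∈σ ∘ q⊆p∪q A (Bset G A))

lemma5p4 : ∀ {m : ℕ} (G : Graph m) (n : ℕ) → 2 ≤ n →
    (A : Subset m) → Independent G A → suc ∣ A ∣ ≡ n →
    (∀ x → x ∉ A → ∣ A ∩ N G x ∣ ≤ 2) →
    Flag (lk (I G n) (A ∪ Bset G A))
lemma5p4 G n _ A indA hA deg≤2 = flag-if-missingFaces-≤2 λ σ (vertex , nonface , proper) →
  ≮⇒≥ λ 3≤∣σ∣ → nonface (lk-face {X = I G n} vertex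
    (αLess-σ∪A∪B G indA hA deg≤2 (lk-vertex⇒∉ {X = I G n} ∘ vertex)
      (λ x∈σ → proj₂ (proper _ (x∈p⇒p-x⊂p x∈σ))) 3≤∣σ∣))
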